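{- Let $G$ be a simple, connected and finite graph of order $n$, and let $X$ be a total independent set of $G$ with $|X| = k$. Then the number $e$ of edges contained in $X$ satisfies $k-\alpha(G) \leq e \leq n - k$.
   Context: Two vertices are adjacent if they are joined by an edge; two edges are adjacent if they share an end vertex; a vertex and an edge are adjacent if the vertex is an end vertex of the edge. $\alpha(G)$ is the maximum size of a set of pairwise non-adjacent vertices. A total independent set is a subset of $V(G)\cup E(G)$ whose elements are pairwise non-adjacent. -}

module Defs where

open import Data.Nat using (ℕ; _<_)
open import Data.Fin using (Fin; toℕ)
open import Data.Bool using (Bool; true; false)
open import Data.List using (List; length; filter)
open import Data.List.Relation.Unary.All using (All)
open import Data.List.Relation.Unary.AllPairs using (AllPairs)
open import Data.List.Relation.Unary.Unique.Propositional using (Unique)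
open import Data.Product using (Σ; _×_; ∃)
open import Data.Sum using (_⊎_)
open import Data.Empty using (⊥)
open import Relation.Nullary using (¬_; yes; no)
open import Relation.Binary.PropositionalEquality using (_≡_)

record Graph (n : ℕ) : Set where
  field
    adj     : Fin n → Fin n → Bool
    symm    : ∀ u v → adj u v ≡ adj v u
    irrefl  : ∀ v → adj v v ≡ false

module _ {n : ℕ} (G : Graph n) where
  open Graph G

  Adj : Fin n → Fin n → Set
  Adj u v = adj u v ≡ true

  data Reach : Fin n → Fin n → Set where
    here : ∀ {v} → Reach v v
    step : ∀ {u w v} → Adj u w → Reach w v → Reach u v

  Connected : Set
  Connected = ∀ u v → Reach u v

  IndependentSet : List (Fin n) → Set
  IndependentSet S = Unique S × AllPairs (λ u v → ¬ Adj u v) S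

  IsIndependenceNumber : ℕ → Set
  IsIndependenceNumber a =
    (Σ (List (Fin n)) λ S → IndependentSet S × length S ≡ a)
    × (∀ S → IndependentSet S → length S Data.Nat.≤ a)

-- elements of V(G) ∪ E(G); an edge {u,v} is stored once, as edge u v with u < v
data Element (n : ℕ) : Set where
  vertex : Fin n → Element n
  edge   : Fin n → Fin n → Element n

isEdge : ∀ {n} → Element n → Bool
isEdge (vertex _) = false
isEdge (edge _ _) = true

module _ {n : ℕ} (G : Graph n) where
  ValidElement : Element n → Set
  ValidElement (vertex _) = Data.Unit.⊤
    where import Data.Unit
  ValidElement (edge u v) = (toℕ u < toℕ v) × Adj G u v

  ElemAdj : Element n → Element n → Set
  ElemAdj (vertex a) (vertex b) = Adj G a b
  ElemAdj (vertex a) (edge u v) = (a ≡ u) ⊎ (a ≡ v)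
  ElemAdj (edge u v) (vertex a) = (a ≡ u) ⊎ (a ≡ v)
  ElemAdj (edge u v) (edge x y) =
    ((u ≡ x) ⊎ (u ≡ y)) ⊎ ((v ≡ x) ⊎ (v ≡ y))

  TotalIndependentSet : List (Element n) → Set
  TotalIndependentSet X =
    All ValidElement X × Unique X × AllPairs (λ x y → ¬ ElemAdj x y) X

  edgeCount : List (Element n) → ℕ
  edgeCount X = length (filter (λ x → isEdge x Data.Bool.≟ true) X)
    where import Data.Bool

-- The vertices in X form an independent set of G, and there are k − e of
-- them, so k − e ≤ α(G). The elements of X are pairwise non-adjacent, hence
-- no vertex of G is covered twice by them: listing the vertex of each
-- vertex-element and both ends of each edge-element gives k + e distinct
-- vertices, so k + e ≤ n.
module Submission where

open import Defs
open import Data.Nat using (ℕ; _≤_; _+_; suc)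
open import Data.Nat.Properties using (+-suc; <-irrefl; +-monoʳ-≤; module ≤-Reasoning)
open import Data.List using (List; []; _∷_; length; lookup; concatMap)
open import Data.List.Membership.Propositional using (_∈_)
open import Data.List.Membership.Propositional.Properties using (∈-lookup)
open import Data.List.Relation.Unary.All as All using (All; []; _∷_)
import Data.List.Relation.Unary.All.Properties as All
open import Data.List.Relation.Unary.Any using (here; there)
open import Data.List.Relation.Unary.AllPairs as AllPairs using (AllPairs; []; _∷_)
import Data.List.Relation.Unary.AllPairs.Properties as AllPairs
open import Data.List.Relation.Unary.Unique.Propositional using (Unique)
import Data.List.Relation.Unary.Unique.Propositional.Properties as Unique
open import Data.List.Relation.Binary.Disjoint.Propositional using (Disjoint)
open import Data.Fin using (Fin; zero; suc)
open import Data.Fin.Properties using (injective⇒≤)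
open import Data.Product using (_×_; _,_)
open import Data.Sum using (_⊎_; inj₁; inj₂)
open import Data.Empty using (⊥-elim)
open import Function using (_∘_; _on_; Injective)
open import Relation.Nullary using (¬_)
open import Relation.Binary.PropositionalEquality using (_≡_; _≢_; refl; sym; cong; trans)

lookup-injective : ∀ {A : Set} {xs : List A} → Unique xs → Injective _≡_ _≡_ (lookup xs)
lookup-injective (_ ∷ _)    {zero}  {zero}  _  = refl
lookup-injective (x∉ ∷ _)   {zero}  {suc j} eq = ⊥-elim (All.lookup x∉ (∈-lookup j) eq)
lookup-injective (x∉ ∷ _)   {suc i} {zero}  eq = ⊥-elim (All.lookup x∉ (∈-lookup i) (sym eq))
lookup-injective (_ ∷ uniq) {suc i} {suc j} eq = cong suc (lookup-injective uniq eq)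

unique⇒length≤ : ∀ {n} {xs : List (Fin n)} → Unique xs → length xs ≤ n
unique⇒length≤ uniq = injective⇒≤ (lookup-injective uniq)

module _ {n : ℕ} where

  endpoints : Element n → List (Fin n)
  endpoints (vertex v) = v ∷ []
  endpoints (edge u v) = u ∷ v ∷ []

  vertexElements : List (Element n) → List (Fin n)
  vertexElements []             = []
  vertexElements (vertex v ∷ X) = v ∷ vertexElements X
  vertexElements (edge _ _ ∷ X) = vertexElements X

  All-vertexElements : ∀ {P : Element n → Set} {X} → All P X → All (P ∘ vertex) (vertexElements X)
  All-vertexElements {X = []}             []         = []
  All-vertexElements {X = vertex _ ∷ _}   (px ∷ pxs) = px ∷ All-vertexElements pxs
  All-vertexElements {X = edge _ _ ∷ _}   (_ ∷ pxs)  = All-vertexElements pxs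

  AllPairs-vertexElements : ∀ {R : Element n → Element n → Set} {X} →
                            AllPairs R X → AllPairs (R on vertex) (vertexElements X)
  AllPairs-vertexElements {X = []}           []         = []
  AllPairs-vertexElements {X = vertex _ ∷ _} (rx ∷ rxs) = All-vertexElements rx ∷ AllPairs-vertexElements rxs
  AllPairs-vertexElements {X = edge _ _ ∷ _} (_ ∷ rxs)  = AllPairs-vertexElements rxs

  module _ (G : Graph n) where

    length≡edgeCount+length-vertexElements : ∀ X → length X ≡ edgeCount G X + length (vertexElements X)
    length≡edgeCount+length-vertexElements []             = refl
    length≡edgeCount+length-vertexElements (vertex _ ∷ X) =
      trans (cong suc (length≡edgeCount+length-vertexElements X)) (sym (+-suc _ _))
    length≡edgeCount+length-vertexElements (edge _ _ ∷ X) =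
      cong suc (length≡edgeCount+length-vertexElements X)

    length-concatMap-endpoints : ∀ X → length (concatMap endpoints X) ≡ edgeCount G X + length X
    length-concatMap-endpoints []             = refl
    length-concatMap-endpoints (vertex _ ∷ X) =
      trans (cong suc (length-concatMap-endpoints X)) (sym (+-suc _ _))
    length-concatMap-endpoints (edge _ _ ∷ X) =
      cong suc (trans (cong suc (length-concatMap-endpoints X)) (sym (+-suc _ _)))

    vertexElements-independent : ∀ {X} → TotalIndependentSet G X → IndependentSet G (vertexElements X)
    vertexElements-independent (_ , uniq , nonAdj) =
        AllPairs.map (λ x≢y a≡b → x≢y (cong vertex a≡b)) (AllPairs-vertexElements uniq)
      , AllPairs-vertexElements nonAdj

    endpoints-unique : ∀ {x} → ValidElement G x → Unique (endpoints x)
    endpoints-unique {vertex _} _          = [] ∷ []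
    endpoints-unique {edge _ _} (u<v , _) = ((λ { refl → <-irrefl refl u<v }) ∷ []) ∷ [] ∷ []

    sharedEndpoint⇒≡⊎adjacent : ∀ {a x y} → a ∈ endpoints x → a ∈ endpoints y → x ≡ y ⊎ ElemAdj G x y
    sharedEndpoint⇒≡⊎adjacent {x = vertex _} {vertex _} (here refl) (here refl)          = inj₁ refl
    sharedEndpoint⇒≡⊎adjacent {x = vertex _} {edge _ _} (here refl) (here refl)          = inj₂ (inj₁ refl)
    sharedEndpoint⇒≡⊎adjacent {x = vertex _} {edge _ _} (here refl) (there (here refl))  = inj₂ (inj₂ refl)
    sharedEndpoint⇒≡⊎adjacent {x = edge _ _} {vertex _} (here refl)         (here refl)  = inj₂ (inj₁ refl)
    sharedEndpoint⇒≡⊎adjacent {x = edge _ _} {vertex _} (there (here refl)) (here refl)  = inj₂ (inj₂ refl)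
    sharedEndpoint⇒≡⊎adjacent {x = edge _ _} {edge _ _} (here refl)         (here refl)         =
      inj₂ (inj₁ (inj₁ refl))
    sharedEndpoint⇒≡⊎adjacent {x = edge _ _} {edge _ _} (here refl)         (there (here refl)) =
      inj₂ (inj₁ (inj₂ refl))
    sharedEndpoint⇒≡⊎adjacent {x = edge _ _} {edge _ _} (there (here refl)) (here refl)         =
      inj₂ (inj₂ (inj₁ refl))
    sharedEndpoint⇒≡⊎adjacent {x = edge _ _} {edge _ _} (there (here refl)) (there (here refl)) =
      inj₂ (inj₂ (inj₂ refl))

    endpoints-disjoint : ∀ {x y} → x ≢ y → ¬ ElemAdj G x y → Disjoint (endpoints x) (endpoints y)
    endpoints-disjoint x≢y nonAdj (a∈x , a∈y) with sharedEndpoint⇒≡⊎adjacent a∈x a∈y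
    ... | inj₁ x≡y = x≢y x≡y
    ... | inj₂ adj = nonAdj adj

    concatMap-endpoints-unique : ∀ {X} → TotalIndependentSet G X → Unique (concatMap endpoints X)
    concatMap-endpoints-unique (valid , uniq , nonAdj) =
      Unique.concat⁺ (All.map⁺ (All.map endpoints-unique valid))
                     (AllPairs.map⁺ (AllPairs.zipWith (λ (x≢y , ¬adj) {_} → endpoints-disjoint x≢y ¬adj)
                                                      (uniq , nonAdj)))

mainTheorem3 : (n : ℕ) (G : Graph n) → Connected G →
    (α : ℕ) → IsIndependenceNumber G α →
    (X : List (Element n)) → TotalIndependentSet G X →
    (k : ℕ) → length X ≡ k →
    (k ≤ edgeCount G X + α) × (edgeCount G X + k ≤ n)
mainTheorem3 n G _ α (_ , α-maximum) X indep k refl = lower , upper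
  where
  open ≤-Reasoning
  e = edgeCount G X

  lower : length X ≤ e + α
  lower = begin
    length X                          ≡⟨ length≡edgeCount+length-vertexElements G X ⟩
    e + length (vertexElements X)     ≤⟨ +-monoʳ-≤ e (α-maximum _ (vertexElements-independent G indep)) ⟩
    e + α                             ∎

  upper : e + length X ≤ n
  upper = begin
    e + length X                      ≡⟨ length-concatMap-endpoints G X ⟨
    length (concatMap endpoints X)    ≤⟨ unique⇒length≤ (concatMap-endpoints-unique G indep) ⟩
    n                                 ∎
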